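{- Let $x$ be a Hamiltonian cycle on $V=\{1,\dots,n\}$ and let $\Pi^x$ be the matrix with $\pi_{i,j}=\pi_{\max}=1-\frac1n$ if $\{i,j\}\in x$ and $\pi_{i,j}=\pi_{\min}=\frac{1}{n(n-2)}$ otherwise ($i\neq j$), $\pi_{i,i}=0$. Let $k\in\{2,3,\dots,n\}$ and let $y$ be a Hamiltonian cycle obtained from $x$ by a $k$-exchange move. Then one run of the vertex-based random solution generation with distribution $\Pi^x$ outputs $y$ with probability $\Omega(1/n^{2k-1})$.
   Context: A Hamiltonian cycle on the complete graph with vertex set $V=\{1,\dots,n\}$ is represented by a permutation of $V$ (permutations describing the same cycle are identified). A $k$-exchange move on a Hamiltonian cycle removes $k$ of its edges and adds $k$ new edges so that a Hamiltonian cycle results. Vertex-based random solution generation from a matrix $\Pi=(\pi_{i,j})$: pick a start vertex $v$ uniformly at random; while unvisited vertices remain (set $U$), choose the next vertex $v'\in U$ with probability $\pi_{v,v'}/\sum_{k\in U}\pi_{v,k}$, append it and set $v=v'$; output the resulting Hamiltonian cycle. (In the paper, $x$ is the iteration-best solution $X_t^{[1]}$ of the cross-entropy algorithm with $M=1,\rho=1$ and max-min calibration, and $\Pi^x$ is the next sampling distribution.) Asymptotic notation refers to $n\to\infty$. -}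

module Defs where

open import Data.Bool using (Bool; true; false; _∧_; _∨_; not; if_then_else_)
open import Data.Nat as ℕ using (ℕ; zero; suc)
open import Data.Integer using (+_)
open import Data.Fin using (Fin)
open import Data.Fin.Properties using (_≟_)
open import Data.Bool.ListAction using (any; all)
open import Data.List using (List; []; _∷_; _++_; [_]; zip; filter; foldr; map; length; reverse)
open import Data.List.Relation.Unary.All using (All)
open import Data.List.Relation.Unary.AllPairs using (AllPairs)
open import Data.List.Relation.Binary.Permutation.Propositional using (_↭_)
open import Data.Product using (Σ; _×_; _,_; proj₁; proj₂)
open import Data.Vec.Functional using ()
open import Data.Fin using () renaming (toℕ to toℕ)
open import Data.List using () renaming (map to lmap)
open import Data.Rational as ℚ using (ℚ; 0ℚ; 1ℚ; _/_; _÷_; _-_)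
import Data.Rational.Properties as ℚP
open import Relation.Nullary using (¬_; yes; no)
open import Relation.Nullary.Decidable using (⌊_⌋; ¬?)
open import Relation.Binary.PropositionalEquality using (_≡_; _≢_)

-- all vertices 0 .. n-1 (the paper's V = {1,..,n})
vertices : (n : ℕ) → List (Fin n)
vertices n = Data.List.allFin n

-- A Hamiltonian cycle is represented by a permutation of V (a vertex
-- ordering); the cycle consists of consecutive pairs plus the closing pair.
Tour : ℕ → Set
Tour n = Σ (List (Fin n)) (λ t → t ↭ vertices n)

rotate : ∀ {A : Set} → List A → List A
rotate []       = []
rotate (a ∷ as) = as ++ [ a ]

edgesL : ∀ {n} → List (Fin n) → List (Fin n × Fin n)
edgesL t = zip t (rotate t)

sameEdgeB : ∀ {n} → Fin n × Fin n → Fin n → Fin n → Bool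
sameEdgeB (a , b) i j = (⌊ a ≟ i ⌋ ∧ ⌊ b ≟ j ⌋) ∨ (⌊ a ≟ j ⌋ ∧ ⌊ b ≟ i ⌋)

inU : ∀ {n} → List (Fin n × Fin n) → Fin n → Fin n → Bool
inU es i j = any (λ e → sameEdgeB e i j) es

adjL : ∀ {n} → List (Fin n) → Fin n → Fin n → Bool
adjL t i j = inU (edgesL t) i j

adj : ∀ {n} → Tour n → Fin n → Fin n → Bool
adj x = adjL (proj₁ x)

sameCycleB : ∀ {n} → List (Fin n) → List (Fin n) → Bool
sameCycleB {n} s t =
  all (λ i → all (λ j → (adjL s i j ∧ adjL t i j) ∨ (not (adjL s i j) ∧ not (adjL t i j)))
                 (vertices n))
      (vertices n)

SameEdge : ∀ {n} → Fin n × Fin n → Fin n × Fin n → Set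
SameEdge e (i , j) = sameEdgeB e i j ≡ true

KExchange : ∀ {n} → ℕ → Tour n → Tour n → Set
KExchange {n} k x y =
  Σ (List (Fin n × Fin n)) λ R → Σ (List (Fin n × Fin n)) λ A →
    (length R ≡ k) × (length A ≡ k) ×
    All (λ e → adj x (proj₁ e) (proj₂ e) ≡ true) R ×
    All (λ e → (adj x (proj₁ e) (proj₂ e) ≡ false) × (proj₁ e ≢ proj₂ e)) A ×
    AllPairs (λ e f → ¬ SameEdge e f) R ×
    AllPairs (λ e f → ¬ SameEdge e f) A ×
    (∀ i j → adj y i j ≡ ((adj x i j ∧ not (inU R i j)) ∨ inU A i j))

-- a / b as a rational (junk value 0 when b = 0; only used with b > 0)
frac : ℕ → ℕ → ℚ
frac a zero    = 0ℚ
frac a (suc b) = (+ a) / suc b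

-- p / q for rationals (junk value 0 when q = 0)
divQ : ℚ → ℚ → ℚ
divQ p q with q ℚP.≟ 0ℚ
... | yes _  = 0ℚ
... | no q≢0 = _÷_ p q {{ℚ.≢-nonZero q≢0}}

sumQ : List ℚ → ℚ
sumQ = foldr ℚ._+_ 0ℚ

piMat : ∀ {n} → Tour n → Fin n → Fin n → ℚ
piMat {n} x i j with i ≟ j
... | yes _ = 0ℚ
... | no  _ = if adj x i j then 1ℚ - frac 1 n else frac 1 (n ℕ.* (n ℕ.∸ 2))

remove : ∀ {n} → Fin n → List (Fin n) → List (Fin n)
remove w U = filter (λ u → ¬? (u ≟ w)) U

-- probability that vertex-based generation, currently at v with
-- unvisited set U and visited path `path` (reversed), ends with an ordering
-- describing the cycle y.  `fuel` = number of remaining steps (= |U|).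
go : ∀ {n} → Tour n → Tour n → ℕ → List (Fin n) → Fin n → List (Fin n) → ℚ
go x y fuel path v [] = if sameCycleB (reverse path) (proj₁ y) then 1ℚ else 0ℚ
go x y zero path v (_ ∷ _) = 0ℚ
go x y (suc fuel) path v U@(_ ∷ _) =
  sumQ (map (λ w → divQ (piMat x v w) (sumQ (map (piMat x v) U))
                     ℚ.* go x y fuel (w ∷ path) w (remove w U)) U)

outProb : ∀ {n} → Tour n → Tour n → ℚ
outProb {n} x y =
  sumQ (map (λ v → frac 1 n ℚ.* go x y n (v ∷ []) v (remove v (vertices n)))
            (vertices n))

module Submission where

-- Let (u , w) be an added edge of y and list the vertices of y as a route from w to u. Started
-- at w, the generation process follows this route with probability at least the product of
-- its step probabilities. With L unvisited vertices and ε = πmin / πmax, a step along an x-edge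
-- out of a vertex whose other x-neighbour is already visited has probability
-- ≥ πmax / (L πmin + πmax) ≥ 1 − L ε, any step along an x-edge has probability ≥ 1/3, and a step
-- along one of the at most k − 1 added edges of the route has probability ≥ πmin / 3. Steps of
-- the middle kind occur only first and right after an added edge, so the product is at least
-- (1/3) (πmin/9)^(k−1) ∏ (1 − L ε) ≥ (1/3) (πmin/9)^(k−1) (1 − Σ L ε) ≥ (1/8) (1/(9 n²))^(k−1),
-- and the start vertex is w with probability 1/n.

open import Algebra.Properties.CommutativeSemigroup using (interchange)
open import Data.Bool using (Bool; true; false; _∧_; _∨_; not; if_then_else_)
import Data.Bool.Properties as Bool
open import Data.Empty using (⊥-elim)
open import Data.Fin using (Fin)
open import Data.Fin.Properties using (_≟_)
open import Data.List using (List; []; _∷_; _++_; [_]; zip; map; length; _ʳ++_)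
import Data.List.Properties as List
open import Data.List.Membership.Propositional using (_∈_; _∉_)
import Data.List.Membership.Propositional.Properties as ∈
open import Data.List.Relation.Binary.Permutation.Propositional using (_↭_; ↭-sym; ↭-trans; ↭-refl; ↭⇒↭ₛ)
import Data.List.Relation.Binary.Permutation.Propositional.Properties as ↭
import Data.List.Relation.Binary.Permutation.Setoid.Properties as ↭ₛ
open import Data.List.Relation.Unary.All as All using (All; []; _∷_)
open import Data.List.Relation.Unary.AllPairs as AllPairs using (AllPairs; []; _∷_)
open import Data.List.Relation.Unary.Any using (here; there)
open import Data.List.Relation.Unary.Unique.Propositional using (Unique)
open import Data.List.Relation.Unary.Unique.Propositional.Properties using (Unique[x∷xs]⇒x∉xs; allFin⁺)
open import Data.Nat as ℕ using (ℕ; zero; suc; z≤n; s≤s; NonZero)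
import Data.Nat.Properties as ℕ
open import Data.Nat.Tactic.RingSolver using (solve-∀)
import Data.Product as Product
open import Data.Product using (Σ; ∃; ∃₂; _×_; _,_; proj₁; proj₂)
open import Data.Sum using (_⊎_; inj₁; inj₂)
open import Relation.Binary.PropositionalEquality hiding ([_]; J)
open import Relation.Nullary using (¬_; Dec; yes; no)
open import Relation.Nullary.Decidable using (⌊_⌋; ¬?)
open import Defs

module RationalFacts where

  open import Data.Integer as ℤ using (+_)
  import Data.Integer.Properties as ℤ
  open import Data.Rational as ℚ using (ℚ; 0ℚ; 1ℚ; _≤_; _<_; _+_; _*_; _-_)
  import Data.Rational.Properties as ℚ
  open import Data.Rational.Solver using (module +-*-Solver)
  open +-*-Solver
  open import Data.Rational.Unnormalised as ℚᵘ using (mkℚᵘ; *≡*; *≤*; *<*)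
  import Data.Rational.Unnormalised.Properties as ℚᵘ

  private
    frac≃ : ∀ a b .{{_ : NonZero b}} → ℚ.toℚᵘ (frac a b) ℚᵘ.≃ mkℚᵘ (+ a) (ℕ.pred b)
    frac≃ a (suc b) = ℚ.toℚᵘ-fromℚᵘ (mkℚᵘ (+ a) b)

  frac-≡ : ∀ a b c d .{{_ : NonZero b}} .{{_ : NonZero d}} →
           a ℕ.* d ≡ c ℕ.* b → frac a b ≡ frac c d
  frac-≡ a b@(suc _) c d@(suc _) h = ℚ.toℚᵘ-injective
    (ℚᵘ.≃-trans (frac≃ a b) (ℚᵘ.≃-trans
      (*≡* (trans (sym (ℤ.pos-* a d)) (trans (cong +_ h) (ℤ.pos-* c b))))
      (ℚᵘ.≃-sym (frac≃ c d))))

  frac-≤ : ∀ a b c d .{{_ : NonZero b}} .{{_ : NonZero d}} →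
           a ℕ.* d ℕ.≤ c ℕ.* b → frac a b ≤ frac c d
  frac-≤ a b@(suc _) c d@(suc _) h = ℚ.toℚᵘ-cancel-≤
    (ℚᵘ.≤-respʳ-≃ (ℚᵘ.≃-sym (frac≃ c d)) (ℚᵘ.≤-respˡ-≃ (ℚᵘ.≃-sym (frac≃ a b))
      (*≤* (subst₂ ℤ._≤_ (ℤ.pos-* a d) (ℤ.pos-* c b) (ℤ.+≤+ h)))))

  frac-< : ∀ a b c d .{{_ : NonZero b}} .{{_ : NonZero d}} →
           a ℕ.* d ℕ.< c ℕ.* b → frac a b < frac c d
  frac-< a b@(suc _) c d@(suc _) h = ℚ.toℚᵘ-cancel-<
    (ℚᵘ.<-respʳ-≃ (ℚᵘ.≃-sym (frac≃ c d)) (ℚᵘ.<-respˡ-≃ (ℚᵘ.≃-sym (frac≃ a b))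
      (*<* (subst₂ ℤ._<_ (ℤ.pos-* a d) (ℤ.pos-* c b) (ℤ.+<+ h)))))

  frac-* : ∀ a b c d .{{_ : NonZero b}} .{{_ : NonZero d}} →
           frac a b * frac c d ≡ frac (a ℕ.* c) (b ℕ.* d)
  frac-* a b@(suc _) c d@(suc _) = ℚ.toℚᵘ-injective
    (ℚᵘ.≃-trans (ℚ.toℚᵘ-homo-* (frac a b) (frac c d))
    (ℚᵘ.≃-trans (ℚᵘ.*-cong (frac≃ a b) (frac≃ c d))
    (ℚᵘ.≃-trans (*≡* (cong (ℤ._* + (b ℕ.* d)) (sym (ℤ.pos-* a c))))
    (ℚᵘ.≃-sym (frac≃ (a ℕ.* c) (b ℕ.* d))))))

  frac-+ : ∀ a b c d .{{_ : NonZero b}} .{{_ : NonZero d}} →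
           frac a b + frac c d ≡ frac (a ℕ.* d ℕ.+ c ℕ.* b) (b ℕ.* d)
  frac-+ a b@(suc _) c d@(suc _) = ℚ.toℚᵘ-injective
    (ℚᵘ.≃-trans (ℚ.toℚᵘ-homo-+ (frac a b) (frac c d))
    (ℚᵘ.≃-trans (ℚᵘ.+-cong (frac≃ a b) (frac≃ c d))
    (ℚᵘ.≃-trans (*≡* (cong (ℤ._* + (b ℕ.* d)) numerator))
    (ℚᵘ.≃-sym (frac≃ (a ℕ.* d ℕ.+ c ℕ.* b) (b ℕ.* d))))))
    where
    numerator : + a ℤ.* + d ℤ.+ + c ℤ.* + b ≡ + (a ℕ.* d ℕ.+ c ℕ.* b)
    numerator = trans (cong₂ ℤ._+_ (sym (ℤ.pos-* a d)) (sym (ℤ.pos-* c b)))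
                      (sym (ℤ.pos-+ (a ℕ.* d) (c ℕ.* b)))

  frac-nonNeg : ∀ a b → 0ℚ ≤ frac a b
  frac-nonNeg a zero    = ℚ.≤-refl
  frac-nonNeg a (suc b) = frac-≤ 0 1 a (suc b) ℕ.z≤n

  frac≤1 : ∀ a b .{{_ : NonZero b}} → a ℕ.≤ b → frac a b ≤ 1ℚ
  frac≤1 a b a≤b = frac-≤ a b 1 1 (subst₂ ℕ._≤_ (sym (ℕ.*-identityʳ a)) (sym (ℕ.*-identityˡ b)) a≤b)

  fromℕ : ℕ → ℚ
  fromℕ L = frac L 1

  fromℕ-+ : ∀ a b → fromℕ (a ℕ.+ b) ≡ fromℕ a + fromℕ b
  fromℕ-+ a b = sym (trans (frac-+ a 1 b 1) (frac-≡ (a ℕ.* 1 ℕ.+ b ℕ.* 1) 1 (a ℕ.+ b) 1 (cross a b)))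
    where
    cross : ∀ a b → (a ℕ.* 1 ℕ.+ b ℕ.* 1) ℕ.* 1 ≡ (a ℕ.+ b) ℕ.* (1 ℕ.* 1)
    cross = solve-∀

  fromℕ-*-frac : ∀ a b .{{_ : NonZero b}} → fromℕ a * frac 1 b ≡ frac a b
  fromℕ-*-frac a b@(suc _) = trans (frac-* a 1 1 b) (frac-≡ (a ℕ.* 1) (1 ℕ.* b) a b (cross a b))
    where
    cross : ∀ a b → a ℕ.* 1 ℕ.* b ≡ a ℕ.* (1 ℕ.* b)
    cross = solve-∀

  fromℕ-mono-≤ : ∀ {a b} → a ℕ.≤ b → fromℕ a ≤ fromℕ b
  fromℕ-mono-≤ {a} {b} a≤b = frac-≤ a 1 b 1 (ℕ.*-monoˡ-≤ 1 a≤b)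

  *-nonNeg : ∀ {p q} → 0ℚ ≤ p → 0ℚ ≤ q → 0ℚ ≤ p * q
  *-nonNeg {p} {q} 0≤p 0≤q = ℚ.nonNegative⁻¹ (p * q)
    {{ℚ.nonNeg*nonNeg⇒nonNeg p {{ℚ.nonNegative 0≤p}} q {{ℚ.nonNegative 0≤q}}}}

  *-pos : ∀ {p q} → 0ℚ < p → 0ℚ < q → 0ℚ < p * q
  *-pos {p} {q} 0<p 0<q = ℚ.positive⁻¹ (p * q) {{ℚ.pos*pos⇒pos p {{ℚ.positive 0<p}} q {{ℚ.positive 0<q}}}}

  *-mono-≤-nonNeg : ∀ {p q r s} → 0ℚ ≤ q → 0ℚ ≤ r → p ≤ q → r ≤ s → p * r ≤ q * s
  *-mono-≤-nonNeg {p} {q} {r} {s} 0≤q 0≤r p≤q r≤s = ℚ.≤-trans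
    (ℚ.*-monoʳ-≤-nonNeg r {{ℚ.nonNegative 0≤r}} p≤q)
    (ℚ.*-monoˡ-≤-nonNeg q {{ℚ.nonNegative 0≤q}} r≤s)

  *-monoˡ-≤ : ∀ {p q} r → 0ℚ ≤ r → p ≤ q → r * p ≤ r * q
  *-monoˡ-≤ r 0≤r = ℚ.*-monoˡ-≤-nonNeg r {{ℚ.nonNegative 0≤r}}

  p≤p+q : ∀ p {q} → 0ℚ ≤ q → p ≤ p + q
  p≤p+q p {q} 0≤q = subst (_≤ p + q) (ℚ.+-identityʳ p) (ℚ.+-monoʳ-≤ p 0≤q)

  p-q≤p : ∀ p {q} → 0ℚ ≤ q → p - q ≤ p
  p-q≤p p 0≤q = subst (p - _ ≤_) (ℚ.+-identityʳ p) (ℚ.+-monoʳ-≤ p (ℚ.neg-antimono-≤ 0≤q))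

  0≤1-p : ∀ {p} → p ≤ 1ℚ → 0ℚ ≤ 1ℚ - p
  0≤1-p {p} p≤1 = subst (_≤ 1ℚ - p) (ℚ.+-inverseʳ p) (ℚ.+-monoˡ-≤ (ℚ.- p) p≤1)

  1-q≤1-p : ∀ {p q} → p ≤ q → 1ℚ - q ≤ 1ℚ - p
  1-q≤1-p p≤q = ℚ.+-monoʳ-≤ 1ℚ (ℚ.neg-antimono-≤ p≤q)

  sumQ-nonNeg : ∀ {A : Set} (f : A → ℚ) xs → (∀ x → 0ℚ ≤ f x) → 0ℚ ≤ sumQ (map f xs)
  sumQ-nonNeg f []       _   = ℚ.≤-refl
  sumQ-nonNeg f (x ∷ xs) f≥0 = ℚ.+-mono-≤ (f≥0 x) (sumQ-nonNeg f xs f≥0)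

  ∈⇒≤sumQ : ∀ {A : Set} (f : A → ℚ) {xs w} → (∀ x → 0ℚ ≤ f x) → w ∈ xs → f w ≤ sumQ (map f xs)
  ∈⇒≤sumQ f {x ∷ xs} f≥0 (here refl) = p≤p+q (f x) (sumQ-nonNeg f xs f≥0)
  ∈⇒≤sumQ f {x ∷ xs} {w} f≥0 (there w∈xs) = subst (_≤ f x + sumQ (map f xs)) (ℚ.+-identityˡ (f w))
    (ℚ.+-mono-≤ (f≥0 x) (∈⇒≤sumQ f f≥0 w∈xs))

  divQ-nonNeg : ∀ p q → 0ℚ ≤ p → 0ℚ ≤ q → 0ℚ ≤ divQ p q
  divQ-nonNeg p q 0≤p 0≤q with q ℚ.≟ 0ℚ
  ... | yes _   = ℚ.≤-refl
  ... | no q≢0 = *-nonNeg 0≤p (ℚ.nonNegative⁻¹ (ℚ.1/ q) {{ℚ.pos⇒nonNeg (ℚ.1/ q) {{ℚ.1/pos⇒pos q}}}})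
    where
    instance
      q>0 : ℚ.Positive q
      q>0 = ℚ.nonNeg∧nonZero⇒pos q {{ℚ.nonNegative 0≤q}} {{ℚ.≢-nonZero q≢0}}
      q≢0′ : ℚ.NonZero q
      q≢0′ = ℚ.pos⇒nonZero q

  divQ-≥ : ∀ {l} p q → 0ℚ < q → l * q ≤ p → l ≤ divQ p q
  divQ-≥ {l} p q q>0 lq≤p with q ℚ.≟ 0ℚ
  ... | yes q≡0 = ⊥-elim (ℚ.<⇒≢ q>0 (sym q≡0))
  ... | no _ = ℚ.≤-trans (ℚ.≤-reflexive l≡lq/q) (ℚ.*-monoʳ-≤-nonNeg (ℚ.1/ q) lq≤p)
    where
    instance
      q>0′ : ℚ.Positive q
      q>0′ = ℚ.positive q>0
      q≢0 : ℚ.NonZero q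
      q≢0 = ℚ.pos⇒nonZero q
      1/q≥0 : ℚ.NonNegative (ℚ.1/ q)
      1/q≥0 = ℚ.pos⇒nonNeg (ℚ.1/ q) {{ℚ.1/pos⇒pos q}}
    l≡lq/q : l ≡ l * q * ℚ.1/ q
    l≡lq/q = sym (trans (ℚ.*-assoc l q (ℚ.1/ q)) (trans (cong (l *_) (ℚ.*-inverseʳ q)) (ℚ.*-identityʳ l)))

  infixr 8 _^ℚ_
  _^ℚ_ : ℚ → ℕ → ℚ
  p ^ℚ zero  = 1ℚ
  p ^ℚ suc j = p * p ^ℚ j

  ^ℚ-nonNeg : ∀ {p} j → 0ℚ ≤ p → 0ℚ ≤ p ^ℚ j
  ^ℚ-nonNeg zero    _   = frac-nonNeg 1 1
  ^ℚ-nonNeg (suc j) 0≤p = *-nonNeg 0≤p (^ℚ-nonNeg j 0≤p)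

  ^ℚ-pos : ∀ {p} j → 0ℚ < p → 0ℚ < p ^ℚ j
  ^ℚ-pos zero    _   = frac-< 0 1 1 1 (ℕ.s≤s ℕ.z≤n)
  ^ℚ-pos (suc j) 0<p = *-pos 0<p (^ℚ-pos j 0<p)

  ^ℚ-monoˡ-≤ : ∀ {p q} j → 0ℚ ≤ p → p ≤ q → p ^ℚ j ≤ q ^ℚ j
  ^ℚ-monoˡ-≤ zero    _   _   = ℚ.≤-refl
  ^ℚ-monoˡ-≤ (suc j) 0≤p p≤q =
    *-mono-≤-nonNeg (ℚ.≤-trans 0≤p p≤q) (^ℚ-nonNeg j 0≤p) p≤q (^ℚ-monoˡ-≤ j 0≤p p≤q)

  ^ℚ-antitoneʳ : ∀ {p} → 0ℚ ≤ p → p ≤ 1ℚ → ∀ {i j} → i ℕ.≤ j → p ^ℚ j ≤ p ^ℚ i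
  ^ℚ-antitoneʳ 0≤p p≤1 {zero} {zero}  _ = ℚ.≤-refl
  ^ℚ-antitoneʳ {p} 0≤p p≤1 {zero} {suc j} _ = subst (p * p ^ℚ j ≤_) (ℚ.*-identityˡ 1ℚ)
    (*-mono-≤-nonNeg (frac-nonNeg 1 1) (^ℚ-nonNeg j 0≤p) p≤1 (^ℚ-antitoneʳ 0≤p p≤1 {zero} {j} ℕ.z≤n))
  ^ℚ-antitoneʳ {p} 0≤p p≤1 {suc i} {suc j} (ℕ.s≤s i≤j) = *-monoˡ-≤ p 0≤p (^ℚ-antitoneʳ 0≤p p≤1 i≤j)

  ^ℚ-distribʳ-* : ∀ p q j → (p * q) ^ℚ j ≡ p ^ℚ j * q ^ℚ j
  ^ℚ-distribʳ-* p q zero    = refl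
  ^ℚ-distribʳ-* p q (suc j) = begin
    p * q * (p * q) ^ℚ j      ≡⟨ cong (p * q *_) (^ℚ-distribʳ-* p q j) ⟩
    p * q * (p ^ℚ j * q ^ℚ j) ≡⟨ solve 4 (λ p q a b → p :* q :* (a :* b) := p :* a :* (q :* b))
                                      refl p q (p ^ℚ j) (q ^ℚ j) ⟩
    p * p ^ℚ j * (q * q ^ℚ j) ∎
    where open ≡-Reasoning

  frac-^ℚ : ∀ b j .{{_ : NonZero b}} → frac 1 b ^ℚ j ≡ frac 1 (b ℕ.^ j)
  frac-^ℚ b zero    = refl
  frac-^ℚ b (suc j) = trans (cong (frac 1 b *_) (frac-^ℚ b j)) (frac-* 1 b 1 (b ℕ.^ j))
    where
    instance
      b^j≢0 : NonZero (b ℕ.^ j)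
      b^j≢0 = ℕ.m^n≢0 b j

module Cycles where

  open import Data.Nat using (_≤_)

  private variable
    n : ℕ

  private
    ∧-true⁻ : ∀ {a b} → a ∧ b ≡ true → (a ≡ true) × (b ≡ true)
    ∧-true⁻ {true} {true} _ = refl , refl

    ∨-true⁻ : ∀ {a b} → a ∨ b ≡ true → (a ≡ true) ⊎ (b ≡ true)
    ∨-true⁻ {true}  _ = inj₁ refl
    ∨-true⁻ {false} h = inj₂ h

    ≟-sound : ∀ (i j : Fin n) → ⌊ i ≟ j ⌋ ≡ true → i ≡ j
    ≟-sound i j h with i ≟ j
    ... | yes i≡j = i≡j

    ≟-refl : ∀ (i : Fin n) → ⌊ i ≟ i ⌋ ≡ true
    ≟-refl i with i ≟ i
    ... | yes _   = refl
    ... | no i≢i = ⊥-elim (i≢i refl)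

  sameEdgeB-sound : ∀ (a b i j : Fin n) → sameEdgeB (a , b) i j ≡ true →
                    ((a ≡ i) × (b ≡ j)) ⊎ ((a ≡ j) × (b ≡ i))
  sameEdgeB-sound a b i j h with ∨-true⁻ {⌊ a ≟ i ⌋ ∧ ⌊ b ≟ j ⌋} h
  ... | inj₁ h₁ = let (p , q) = ∧-true⁻ h₁ in inj₁ (≟-sound a i p , ≟-sound b j q)
  ... | inj₂ h₂ = let (p , q) = ∧-true⁻ h₂ in inj₂ (≟-sound a j p , ≟-sound b i q)

  sameEdgeB-refl : ∀ (i j : Fin n) → sameEdgeB (i , j) i j ≡ true
  sameEdgeB-refl i j rewrite ≟-refl i | ≟-refl j = refl

  sameEdgeB-flip : ∀ (i j : Fin n) → sameEdgeB (j , i) i j ≡ true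
  sameEdgeB-flip i j rewrite ≟-refl i | ≟-refl j = Bool.∨-zeroʳ _

  sameEdgeB-sym : ∀ (e : Fin n × Fin n) i j → sameEdgeB e i j ≡ sameEdgeB e j i
  sameEdgeB-sym (a , b) i j = Bool.∨-comm (⌊ a ≟ i ⌋ ∧ ⌊ b ≟ j ⌋) _

  SameEdge-trans : ∀ {d e f : Fin n × Fin n} → SameEdge d e → SameEdge d f → SameEdge e f
  SameEdge-trans {d = a , b} {e₁ , e₂} {i , j} d~e d~f
    with sameEdgeB-sound a b e₁ e₂ d~e | sameEdgeB-sound a b i j d~f
  ... | inj₁ (refl , refl) | inj₁ (refl , refl) = sameEdgeB-refl i j
  ... | inj₁ (refl , refl) | inj₂ (refl , refl) = sameEdgeB-flip i j
  ... | inj₂ (refl , refl) | inj₁ (refl , refl) = sameEdgeB-flip i j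
  ... | inj₂ (refl , refl) | inj₂ (refl , refl) = sameEdgeB-refl i j

  inU-sound : ∀ (es : List (Fin n × Fin n)) i j → inU es i j ≡ true →
              ∃ λ e → e ∈ es × SameEdge e (i , j)
  inU-sound (e ∷ es) i j h with ∨-true⁻ {sameEdgeB e i j} h
  ... | inj₁ e~ij = e , here refl , e~ij
  ... | inj₂ h′   = let (e′ , e′∈es , e′~ij) = inU-sound es i j h′ in e′ , there e′∈es , e′~ij

  inU-complete : ∀ {es : List (Fin n × Fin n)} {e} i j → e ∈ es → SameEdge e (i , j) → inU es i j ≡ true
  inU-complete {es = e ∷ es} i j (here refl) e~ij rewrite e~ij = refl
  inU-complete {es = e ∷ es} i j (there e∈es) e~ij rewrite inU-complete i j e∈es e~ij = Bool.∨-zeroʳ _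

  inU-sym : ∀ (es : List (Fin n × Fin n)) i j → inU es i j ≡ inU es j i
  inU-sym []       i j = refl
  inU-sym (e ∷ es) i j = cong₂ _∨_ (sameEdgeB-sym e i j) (inU-sym es i j)

  inU-++ : ∀ (es fs : List (Fin n × Fin n)) i j → inU (es ++ fs) i j ≡ inU es i j ∨ inU fs i j
  inU-++ []       fs i j = refl
  inU-++ (e ∷ es) fs i j rewrite inU-++ es fs i j = sym (Bool.∨-assoc (sameEdgeB e i j) _ _)

  adj-sym : ∀ (x : Tour n) i j → adj x i j ≡ adj x j i
  adj-sym x = inU-sym (edgesL (proj₁ x))

  edgesL-rotate : ∀ (a b : Fin n) s → edgesL (rotate (a ∷ b ∷ s)) ≡ zip (b ∷ s) (s ++ [ a ]) ++ [ (a , b) ]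
  edgesL-rotate a b s = zip-∷ʳ (b ∷ s) (s ++ [ a ]) (sym (List.length-++-comm s [ a ]))
    where
    zip-∷ʳ : ∀ {A B : Set} (xs : List A) (ys : List B) {a b} → length xs ≡ length ys →
             zip (xs ++ [ a ]) (ys ++ [ b ]) ≡ zip xs ys ++ [ (a , b) ]
    zip-∷ʳ []       []       _ = refl
    zip-∷ʳ (x ∷ xs) (y ∷ ys) h = cong ((x , y) ∷_) (zip-∷ʳ xs ys (ℕ.suc-injective h))

  adjL-rotate : ∀ (t : List (Fin n)) i j → adjL (rotate t) i j ≡ adjL t i j
  adjL-rotate []          i j = refl
  adjL-rotate (a ∷ [])    i j = refl
  adjL-rotate {n} (a ∷ b ∷ s) i j = begin
    inU (edgesL (rotate (a ∷ b ∷ s))) i j            ≡⟨ cong (λ es → inU es i j) (edgesL-rotate a b s) ⟩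
    inU (steps ++ [ (a , b) ]) i j                   ≡⟨ inU-++ steps [ (a , b) ] i j ⟩
    inU steps i j ∨ (sameEdgeB (a , b) i j ∨ false)  ≡⟨ Bool.∨-comm (inU steps i j) _ ⟩
    (sameEdgeB (a , b) i j ∨ false) ∨ inU steps i j  ≡⟨ cong (_∨ inU steps i j) (Bool.∨-identityʳ _) ⟩
    sameEdgeB (a , b) i j ∨ inU steps i j            ∎
    where
    open ≡-Reasoning
    steps : List (Fin n × Fin n)
    steps = zip (b ∷ s) (s ++ [ a ])

  rotate-↭ : ∀ {A : Set} (t : List A) → rotate t ↭ t
  rotate-↭ []      = ↭-refl
  rotate-↭ (a ∷ s) = ↭.++-comm s [ a ]

  record Rotation (t : List (Fin n)) (u w : Fin n) : Set where
    field
      mid     : List (Fin n)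
      perm    : (w ∷ mid ++ [ u ]) ↭ t
      sameAdj : ∀ i j → adjL (w ∷ mid ++ [ u ]) i j ≡ adjL t i j

  -- Rotating t moves its first directed edge to the end; repeat until (u , w) is the closing edge.
  rotate-to : ∀ (t : List (Fin n)) {u w} → u ≢ w → (u , w) ∈ edgesL t → Rotation t u w
  rotate-to t {u} {w} u≢w uw∈t = let (L , M , eq) = ∈.∈-∃++ uw∈t in shift L M t eq
    where
    shift : ∀ L M t → edgesL t ≡ L ++ (u , w) ∷ M → Rotation t u w
    shift []          M (a ∷ [])    eq with List.∷-injectiveˡ eq
    ... | refl = ⊥-elim (u≢w refl)
    shift []          M (a ∷ b ∷ s) eq with List.∷-injectiveˡ eq
    ... | refl = record { mid = s ; perm = rotate-↭ (a ∷ b ∷ s) ; sameAdj = adjL-rotate (a ∷ b ∷ s) }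
    shift (_ ∷ [])    M (a ∷ [])    ()
    shift (_ ∷ _ ∷ _) M (a ∷ [])    ()
    shift (_ ∷ L)     M (a ∷ b ∷ s) eq = record
      { mid     = mid
      ; perm    = ↭-trans perm (rotate-↭ (a ∷ b ∷ s))
      ; sameAdj = λ i j → trans (sameAdj i j) (adjL-rotate (a ∷ b ∷ s) i j)
      }
      where
      open Rotation (shift L (M ++ [ (a , b) ]) (rotate (a ∷ b ∷ s))
        (trans (edgesL-rotate a b s) (trans (cong (_++ [ (a , b) ]) (List.∷-injectiveʳ eq))
               (List.++-assoc L ((u , w) ∷ M) [ (a , b) ]))))

  unique-resp-↭ : ∀ {A : Set} {xs ys : List A} → Unique xs → xs ↭ ys → Unique ys
  unique-resp-↭ {A} u p = ↭ₛ.Unique-resp-↭ (setoid A) (↭⇒↭ₛ p) u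

  tour-unique : ∀ (x : Tour n) → Unique (proj₁ x)
  tour-unique {n} x = unique-resp-↭ (allFin⁺ n) (↭-sym (proj₂ x))

  AtMostTwo : (Fin n → Bool) → Set
  AtMostTwo f = ∃₂ λ p q → ∀ u → f u ≡ true → (u ≡ p) ⊎ (u ≡ q)

  private
    zip-∈ˡ : ∀ {A B : Set} (l : List A) (s : List B) {a b} → (a , b) ∈ zip l s → a ∈ l
    zip-∈ˡ (x ∷ l) (y ∷ s) (here refl) = here refl
    zip-∈ˡ (x ∷ l) (y ∷ s) (there ab∈) = there (zip-∈ˡ l s ab∈)

    zip-swap : ∀ {A B : Set} (l : List A) (s : List B) {a b} → (a , b) ∈ zip l s → (b , a) ∈ zip s l
    zip-swap (x ∷ l) (y ∷ s) (here refl) = here refl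
    zip-swap (x ∷ l) (y ∷ s) (there ab∈) = there (zip-swap l s ab∈)

    zip-functional : ∀ (l s : List (Fin n)) v → Unique l → ∃ λ q → ∀ b → (v , b) ∈ zip l s → b ≡ q
    zip-functional []      s       v _ = v , λ _ ()
    zip-functional (a ∷ l) []      v _ = v , λ _ ()
    zip-functional (a ∷ l) (c ∷ s) v (a∉l ∷ ul) with a ≟ v
    ... | yes refl = c , λ where
          _ (here refl) → refl
          _ (there ab∈) → ⊥-elim (Unique[x∷xs]⇒x∉xs (a∉l ∷ ul) (zip-∈ˡ l s ab∈))
    ... | no a≢v = let (q , only-q) = zip-functional l s v ul in q , λ where
          _ (here refl) → ⊥-elim (a≢v refl)
          b (there vb∈) → only-q b vb∈

  adjL-atMostTwo : ∀ (t : List (Fin n)) v → Unique t → AtMostTwo (adjL t v)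
  adjL-atMostTwo t v ut
    with zip-functional t (rotate t) v ut
       | zip-functional (rotate t) t v (unique-resp-↭ ut (↭-sym (rotate-↭ t)))
  ... | p , after | q , before = p , q , λ u vu∈t → neighbour u (inU-sound (edgesL t) v u vu∈t)
    where
    neighbour : ∀ u → (∃ λ e → e ∈ edgesL t × SameEdge e (v , u)) → (u ≡ p) ⊎ (u ≡ q)
    neighbour u ((e₁ , e₂) , e∈ , e~vu) with sameEdgeB-sound e₁ e₂ v u e~vu
    ... | inj₁ (refl , refl) = inj₁ (after u e∈)
    ... | inj₂ (refl , refl) = inj₂ (before u (zip-swap t (rotate t) e∈))

  adj-atMostTwo : ∀ (x : Tour n) v → AtMostTwo (adj x v)
  adj-atMostTwo x v = adjL-atMostTwo (proj₁ x) v (tour-unique x)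

  indicator : Bool → ℕ
  indicator true  = 1
  indicator false = 0

  countTrue : (Fin n → Bool) → List (Fin n) → ℕ
  countTrue f []      = 0
  countTrue f (u ∷ U) = indicator (f u) ℕ.+ countTrue f U

  private
    count≡ : Fin n → List (Fin n) → ℕ
    count≡ p = countTrue (λ u → ⌊ u ≟ p ⌋)

    count≡-∉ : ∀ (p : Fin n) U → p ∉ U → count≡ p U ≡ 0
    count≡-∉ p []      _   = refl
    count≡-∉ p (u ∷ U) p∉ with u ≟ p
    ... | yes refl = ⊥-elim (p∉ (here refl))
    ... | no _     = count≡-∉ p U (λ p∈U → p∉ (there p∈U))

    count≡-≤1 : ∀ (p : Fin n) U → Unique U → count≡ p U ≤ 1
    count≡-≤1 p []      _ = z≤n
    count≡-≤1 p (u ∷ U) uU@(_ ∷ uU′) with u ≟ p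
    ... | yes refl rewrite count≡-∉ u U (Unique[x∷xs]⇒x∉xs uU) = s≤s z≤n
    ... | no _     = count≡-≤1 p U uU′

    countTrue-≤-pair : ∀ {f : Fin n → Bool} {p q} → (∀ u → f u ≡ true → (u ≡ p) ⊎ (u ≡ q)) →
                       ∀ U → countTrue f U ≤ count≡ p U ℕ.+ count≡ q U
    countTrue-≤-pair only []      = z≤n
    countTrue-≤-pair {f = f} {p} {q} only (u ∷ U) = begin
      indicator (f u) ℕ.+ countTrue f U
        ≤⟨ ℕ.+-mono-≤ (head-≤ (f u) refl) (countTrue-≤-pair only U) ⟩
      (ip ℕ.+ iq) ℕ.+ (count≡ p U ℕ.+ count≡ q U)
        ≡⟨ interchange ℕ.+-commutativeSemigroup ip iq (count≡ p U) (count≡ q U) ⟩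
      count≡ p (u ∷ U) ℕ.+ count≡ q (u ∷ U) ∎
      where
      open ℕ.≤-Reasoning
      ip iq : ℕ
      ip = indicator ⌊ u ≟ p ⌋
      iq = indicator ⌊ u ≟ q ⌋
      head-≤ : ∀ b → f u ≡ b → indicator b ≤ ip ℕ.+ iq
      head-≤ false _ = z≤n
      head-≤ true fu with only u fu
      ... | inj₁ refl rewrite ≟-refl u = s≤s z≤n
      ... | inj₂ refl rewrite ≟-refl u = ℕ.m≤n+m 1 ip

  countTrue-≤2 : ∀ {f : Fin n → Bool} → AtMostTwo f → ∀ U → Unique U → countTrue f U ≤ 2
  countTrue-≤2 (p , q , only) U uU =
    ℕ.≤-trans (countTrue-≤-pair only U) (ℕ.+-mono-≤ (count≡-≤1 p U uU) (count≡-≤1 q U uU))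

  countTrue-≤1 : ∀ {f : Fin n → Bool} → AtMostTwo f → ∀ U → Unique U →
                 ∀ {u₀} → f u₀ ≡ true → u₀ ∉ U → countTrue f U ≤ 1
  countTrue-≤1 (p , q , only) U uU {u₀} fu₀ u₀∉U with only u₀ fu₀
  ... | inj₁ refl = ℕ.≤-trans (countTrue-≤-pair only U)
        (ℕ.+-mono-≤ (ℕ.≤-reflexive (count≡-∉ u₀ U u₀∉U)) (count≡-≤1 q U uU))
  ... | inj₂ refl = ℕ.≤-trans (countTrue-≤-pair only U)
        (ℕ.≤-trans (ℕ.+-mono-≤ (count≡-≤1 p U uU) (ℕ.≤-reflexive (count≡-∉ u₀ U u₀∉U))) (s≤s z≤n))

  remove-↭ : ∀ {w : Fin n} {U rest} → U ↭ w ∷ rest → w ∉ rest → remove w U ↭ rest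
  remove-↭ {n} {w} {U} {rest} U↭w∷rest w∉rest =
    subst (remove w U ↭_) (trans (List.filter-reject ≢w? (λ w≢w → w≢w refl)) (List.filter-all ≢w? rest≢w))
      (↭.filter-↭ ≢w? U↭w∷rest)
    where
    ≢w? : ∀ (u : Fin n) → Dec (¬ (u ≡ w))
    ≢w? u = ¬? (u ≟ w)
    rest≢w : All (λ u → ¬ (u ≡ w)) rest
    rest≢w = All.tabulate (λ { u∈rest refl → w∉rest u∈rest })

  offTourSteps : Tour n → List (Fin n) → List (Fin n × Fin n)
  offTourSteps x (v ∷ w ∷ rs) = if adj x v w then offTourSteps x (w ∷ rs) else (v , w) ∷ offTourSteps x (w ∷ rs)
  offTourSteps x _            = []

  SameEdge-endpoints : ∀ {a b e₁ e₂ : Fin n} {l} → e₁ ∈ l → e₂ ∈ l → SameEdge (a , b) (e₁ , e₂) →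
                       (a ∈ l) × (b ∈ l)
  SameEdge-endpoints {a = a} {b} {e₁} {e₂} e₁∈ e₂∈ ab~e with sameEdgeB-sound a b e₁ e₂ ab~e
  ... | inj₁ (refl , refl) = e₁∈ , e₂∈
  ... | inj₂ (refl , refl) = e₂∈ , e₁∈

  module _ (x : Tour n) where

    offTourSteps-offTour : ∀ l → All (λ e → adj x (proj₁ e) (proj₂ e) ≡ false) (offTourSteps x l)
    offTourSteps-offTour []           = []
    offTourSteps-offTour (v ∷ [])     = []
    offTourSteps-offTour (v ∷ w ∷ rs) with adj x v w in vw | offTourSteps-offTour (w ∷ rs)
    ... | true  | ih = ih
    ... | false | ih = vw ∷ ih

    offTourSteps-⊆-zip : ∀ a s c → All (_∈ zip (a ∷ s) (s ++ [ c ])) (offTourSteps x (a ∷ s))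
    offTourSteps-⊆-zip a []      c = []
    offTourSteps-⊆-zip a (b ∷ s) c with adj x a b | offTourSteps-⊆-zip b s c
    ... | true  | ih = All.map there ih
    ... | false | ih = here refl ∷ All.map there ih

    offTourSteps-endpoints : ∀ l → All (λ e → (proj₁ e ∈ l) × (proj₂ e ∈ l)) (offTourSteps x l)
    offTourSteps-endpoints []           = []
    offTourSteps-endpoints (v ∷ [])     = []
    offTourSteps-endpoints (v ∷ w ∷ rs) with adj x v w | offTourSteps-endpoints (w ∷ rs)
    ... | true  | ih = All.map (Product.map there there) ih
    ... | false | ih = (here refl , there (here refl)) ∷ All.map (Product.map there there) ih

    offTourSteps-distinct : ∀ l → Unique l → AllPairs (λ e f → ¬ SameEdge e f) (offTourSteps x l)
    offTourSteps-distinct []           _ = []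
    offTourSteps-distinct (v ∷ [])     _ = []
    offTourSteps-distinct (v ∷ w ∷ rs) uvl@(_ ∷ ul) with adj x v w | offTourSteps-distinct (w ∷ rs) ul
    ... | true  | ih = ih
    ... | false | ih = All.map fresh (offTourSteps-endpoints (w ∷ rs)) ∷ ih
      where
      fresh : ∀ {e} → (proj₁ e ∈ w ∷ rs) × (proj₂ e ∈ w ∷ rs) → ¬ SameEdge (v , w) e
      fresh (e₁∈ , e₂∈) vw~e = Unique[x∷xs]⇒x∉xs uvl (proj₁ (SameEdge-endpoints {b = w} e₁∈ e₂∈ vw~e))

    outsideEndpoint-fresh : ∀ {u w} l → w ∉ l → All (λ e → ¬ SameEdge (u , w) e) (offTourSteps x l)
    outsideEndpoint-fresh {u} {w} l w∉l = All.map fresh (offTourSteps-endpoints l)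
      where
      fresh : ∀ {e} → (proj₁ e ∈ l) × (proj₂ e ∈ l) → ¬ SameEdge (u , w) e
      fresh (e₁∈ , e₂∈) uw~e = w∉l (proj₂ (SameEdge-endpoints {a = u} e₁∈ e₂∈ uw~e))

    closingEdge-fresh : ∀ {u w b s} → Unique (w ∷ b ∷ s) → u ∈ s →
                        All (λ e → ¬ SameEdge (u , w) e) (offTourSteps x (w ∷ b ∷ s))
    closingEdge-fresh {u} {w} {b} {s} uwbs@(_ ∷ ubs) u∈s with adj x w b
    ... | true  = outsideEndpoint-fresh {u} (b ∷ s) (Unique[x∷xs]⇒x∉xs uwbs)
    ... | false = first ∷ outsideEndpoint-fresh {u} (b ∷ s) (Unique[x∷xs]⇒x∉xs uwbs)
      where
      first : ¬ SameEdge (u , w) (w , b)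
      first uw~wb with sameEdgeB-sound u w w b uw~wb
      ... | inj₁ (_ , w≡b)  = Unique[x∷xs]⇒x∉xs uwbs (here w≡b)
      ... | inj₂ (refl , _) = Unique[x∷xs]⇒x∉xs ubs u∈s

  private
    inU-delete : ∀ (A₁ : List (Fin n × Fin n)) {a} A₂ {i j} →
                 inU (A₁ ++ a ∷ A₂) i j ≡ true → ¬ SameEdge a (i , j) → inU (A₁ ++ A₂) i j ≡ true
    inU-delete [] {a} A₂ {i} {j} h a≁ij with sameEdgeB a i j
    ... | true  = ⊥-elim (a≁ij refl)
    ... | false = h
    inU-delete (b ∷ A₁) A₂ {i} {j} h a≁ij with sameEdgeB b i j
    ... | true  = refl
    ... | false = inU-delete A₁ A₂ h a≁ij

  distinctEdges-length-≤ : ∀ (E A : List (Fin n × Fin n)) → AllPairs (λ e f → ¬ SameEdge e f) E →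
                           All (λ e → inU A (proj₁ e) (proj₂ e) ≡ true) E → length E ≤ length A
  distinctEdges-length-≤ []              A _ _ = z≤n
  distinctEdges-length-≤ ((i , j) ∷ E) A (ij≁E ∷ distinct) (ij∈A ∷ E⊆A)
    with inU-sound A i j ij∈A
  ... | a , a∈A , a~ij with ∈.∈-∃++ a∈A
  ... | A₁ , A₂ , refl = ℕ.≤-trans
    (s≤s (distinctEdges-length-≤ E (A₁ ++ A₂) distinct (All.zipWith shrink (ij≁E , E⊆A))))
    (ℕ.≤-reflexive (sym (List.length-++-sucʳ A₁ a A₂)))
    where
    shrink : ∀ {f} → ¬ SameEdge (i , j) f × (inU (A₁ ++ a ∷ A₂) (proj₁ f) (proj₂ f) ≡ true) →
             inU (A₁ ++ A₂) (proj₁ f) (proj₂ f) ≡ true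
    shrink (ij≁f , f∈A) = inU-delete A₁ A₂ f∈A (λ a~f → ij≁f (SameEdge-trans {d = a} a~ij a~f))

  sameCycleB-complete : ∀ (s t : List (Fin n)) → (∀ i j → adjL s i j ≡ adjL t i j) → sameCycleB s t ≡ true
  sameCycleB-complete {n} s t same = all≡true (allFin n) λ i → all≡true (allFin n) λ j → agree (same i j)
    where
    open import Data.Bool.ListAction using (all)
    open import Data.List using (allFin)
    all≡true : ∀ {A : Set} {f : A → Bool} l → (∀ a → f a ≡ true) → all f l ≡ true
    all≡true []      _     = refl
    all≡true {f = f} (a ∷ l) f≡true rewrite f≡true a = all≡true l f≡true
    agree : ∀ {a b} → a ≡ b → (a ∧ b) ∨ (not a ∧ not b) ≡ true
    agree {true}  refl = refl
    agree {false} refl = refl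

-- Everything is stated for n = 10 + m; n ≥ 10 is what makes loss (n − 1) ≤ 5/8.
module Constants (m : ℕ) where

  open import Data.Rational as ℚ using (ℚ; 0ℚ; 1ℚ; _≤_; _<_; _+_; _*_; _-_)
  import Data.Rational.Properties as ℚ
  open import Data.Rational.Solver using (module +-*-Solver)
  open +-*-Solver
  open RationalFacts

  n : ℕ
  n = 10 ℕ.+ m

  private
    D : ℕ
    D = (9 ℕ.+ m) ℕ.* (8 ℕ.+ m)

  πmax πmin ε third : ℚ
  πmax  = 1ℚ - frac 1 n
  πmin  = frac 1 (n ℕ.* (n ℕ.∸ 2))
  ε     = frac 1 D
  third = frac 1 3

  πmax≡9+m/n : πmax ≡ frac (9 ℕ.+ m) n
  πmax≡9+m/n = begin
    1ℚ - frac 1 n                         ≡⟨ cong (_- frac 1 n) 1≡ ⟩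
    frac (9 ℕ.+ m) n + frac 1 n - frac 1 n ≡⟨ solve 2 (λ a b → a :+ b :- b := a) refl (frac (9 ℕ.+ m) n) (frac 1 n) ⟩
    frac (9 ℕ.+ m) n                      ∎
    where
    open ≡-Reasoning
    cross : ∀ m → ((9 ℕ.+ m) ℕ.* (10 ℕ.+ m) ℕ.+ 1 ℕ.* (10 ℕ.+ m)) ℕ.* 1
                ≡ 1 ℕ.* ((10 ℕ.+ m) ℕ.* (10 ℕ.+ m))
    cross = solve-∀
    1≡ : 1ℚ ≡ frac (9 ℕ.+ m) n + frac 1 n
    1≡ = sym (trans (frac-+ (9 ℕ.+ m) n 1 n) (frac-≡ ((9 ℕ.+ m) ℕ.* n ℕ.+ 1 ℕ.* n) (n ℕ.* n) 1 1 (cross m)))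

  πmin≡ε*πmax : πmin ≡ ε * πmax
  πmin≡ε*πmax = sym (begin
    ε * πmax                                      ≡⟨ cong (ε *_) πmax≡9+m/n ⟩
    ε * frac (9 ℕ.+ m) n                          ≡⟨ frac-* 1 D (9 ℕ.+ m) n ⟩
    frac (1 ℕ.* (9 ℕ.+ m)) (D ℕ.* n)              ≡⟨ frac-≡ (1 ℕ.* (9 ℕ.+ m)) (D ℕ.* n) 1 (n ℕ.* (8 ℕ.+ m)) (cross m) ⟩
    πmin                                          ∎)
    where
    open ≡-Reasoning
    cross : ∀ m → 1 ℕ.* (9 ℕ.+ m) ℕ.* ((10 ℕ.+ m) ℕ.* (8 ℕ.+ m))
                ≡ 1 ℕ.* ((9 ℕ.+ m) ℕ.* (8 ℕ.+ m) ℕ.* (10 ℕ.+ m))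
    cross = solve-∀

  πmax-pos : 0ℚ < πmax
  πmax-pos = subst (0ℚ <_) (sym πmax≡9+m/n) (frac-< 0 1 (9 ℕ.+ m) n (s≤s z≤n))

  πmax≤1 : πmax ≤ 1ℚ
  πmax≤1 = subst (_≤ 1ℚ) (sym πmax≡9+m/n)
    (frac-≤ (9 ℕ.+ m) n 1 1 (ℕ.≤-trans (ℕ.n≤1+n _) (ℕ.≤-reflexive (cross m))))
    where
    cross : ∀ m → suc ((9 ℕ.+ m) ℕ.* 1) ≡ 1 ℕ.* (10 ℕ.+ m)
    cross = solve-∀

  πmin-pos : 0ℚ < πmin
  πmin-pos = frac-< 0 1 1 (n ℕ.* (8 ℕ.+ m)) (s≤s z≤n)

  fromℕ*ε≤1 : ∀ {L} → L ℕ.≤ n → fromℕ L * ε ≤ 1ℚ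
  fromℕ*ε≤1 {L} L≤n = subst (_≤ 1ℚ) (sym (fromℕ-*-frac L D)) (frac≤1 L D (ℕ.≤-trans L≤n (n≤D m)))
    where
    n≤D : ∀ m → 10 ℕ.+ m ℕ.≤ (9 ℕ.+ m) ℕ.* (8 ℕ.+ m)
    n≤D m = subst (10 ℕ.+ m ℕ.≤_) (expand m) (ℕ.m≤m+n (10 ℕ.+ m) (62 ℕ.+ 16 ℕ.* m ℕ.+ m ℕ.* m))
      where
      expand : ∀ m → 10 ℕ.+ m ℕ.+ (62 ℕ.+ 16 ℕ.* m ℕ.+ m ℕ.* m) ≡ (9 ℕ.+ m) ℕ.* (8 ℕ.+ m)
      expand = solve-∀

  -- loss L = ε (1 + 2 + ⋯ + L)
  loss : ℕ → ℚ
  loss L = frac (L ℕ.* suc L) (2 ℕ.* D)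

  loss-suc : ∀ L → loss (suc L) ≡ loss L + fromℕ (suc L) * ε
  loss-suc L = sym (begin
    loss L + fromℕ (suc L) * ε            ≡⟨ cong (loss L +_) (fromℕ-*-frac (suc L) D) ⟩
    loss L + frac (suc L) D               ≡⟨ frac-+ (L ℕ.* suc L) (2 ℕ.* D) (suc L) D ⟩
    frac (L ℕ.* suc L ℕ.* D ℕ.+ suc L ℕ.* (2 ℕ.* D)) (2 ℕ.* D ℕ.* D)
                                          ≡⟨ frac-≡ (L ℕ.* suc L ℕ.* D ℕ.+ suc L ℕ.* (2 ℕ.* D)) (2 ℕ.* D ℕ.* D)
                                               (suc L ℕ.* suc (suc L)) (2 ℕ.* D) (cross L D) ⟩
    loss (suc L)                          ∎)
    where
    open ≡-Reasoning
    cross : ∀ L D → (L ℕ.* suc L ℕ.* D ℕ.+ suc L ℕ.* (2 ℕ.* D)) ℕ.* (2 ℕ.* D)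
                  ≡ suc L ℕ.* suc (suc L) ℕ.* (2 ℕ.* D ℕ.* D)
    cross = solve-∀

  loss-nonNeg : ∀ L → 0ℚ ≤ loss L
  loss-nonNeg L = frac-nonNeg (L ℕ.* suc L) (2 ℕ.* D)

  loss≤5/8 : ∀ {L} → L ℕ.≤ 9 ℕ.+ m → loss L ≤ frac 5 8
  loss≤5/8 {L} L≤ = frac-≤ (L ℕ.* suc L) (2 ℕ.* D) 5 8 (begin
    L ℕ.* suc L ℕ.* 8                                       ≤⟨ ℕ.*-monoˡ-≤ 8 (ℕ.*-mono-≤ L≤ (s≤s L≤)) ⟩
    (9 ℕ.+ m) ℕ.* (10 ℕ.+ m) ℕ.* 8                          ≤⟨ ℕ.m≤m+n _ (2 ℕ.* m ℕ.* (9 ℕ.+ m)) ⟩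
    (9 ℕ.+ m) ℕ.* (10 ℕ.+ m) ℕ.* 8 ℕ.+ 2 ℕ.* m ℕ.* (9 ℕ.+ m) ≡⟨ expand m ⟩
    5 ℕ.* (2 ℕ.* D)                                         ∎)
    where
    open ℕ.≤-Reasoning
    expand : ∀ m → (9 ℕ.+ m) ℕ.* (10 ℕ.+ m) ℕ.* 8 ℕ.+ 2 ℕ.* m ℕ.* (9 ℕ.+ m)
                 ≡ 5 ℕ.* (2 ℕ.* ((9 ℕ.+ m) ℕ.* (8 ℕ.+ m)))
    expand = solve-∀

  loss≤1 : ∀ {L} → L ℕ.≤ 9 ℕ.+ m → loss L ≤ 1ℚ
  loss≤1 L≤ = ℚ.≤-trans (loss≤5/8 L≤) (frac≤1 5 8 (ℕ.m≤m+n 5 3))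

  third-nonNeg : 0ℚ ≤ third
  third-nonNeg = frac-nonNeg 1 3

  third≤1 : third ≤ 1ℚ
  third≤1 = frac≤1 1 3 (s≤s z≤n)

  ε-nonNeg : 0ℚ ≤ ε
  ε-nonNeg = frac-nonNeg 1 D

  πmax-nonNeg : 0ℚ ≤ πmax
  πmax-nonNeg = ℚ.<⇒≤ πmax-pos

  πmin-nonNeg : 0ℚ ≤ πmin
  πmin-nonNeg = ℚ.<⇒≤ πmin-pos

  fromℕ*πmin≤πmax : ∀ {L} → L ℕ.≤ n → fromℕ L * πmin ≤ πmax
  fromℕ*πmin≤πmax {L} L≤n = begin
    fromℕ L * πmin        ≡⟨ cong (fromℕ L *_) πmin≡ε*πmax ⟩
    fromℕ L * (ε * πmax)  ≡⟨ ℚ.*-assoc (fromℕ L) ε πmax ⟨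
    fromℕ L * ε * πmax    ≤⟨ ℚ.*-monoʳ-≤-nonNeg πmax {{ℚ.nonNegative πmax-nonNeg}} (fromℕ*ε≤1 L≤n) ⟩
    1ℚ * πmax             ≡⟨ ℚ.*-identityˡ πmax ⟩
    πmax                  ∎
    where open ℚ.≤-Reasoning

  forcedStep-bound : ∀ {L Z} → L ℕ.≤ n → 0ℚ ≤ Z → Z ≤ fromℕ L * πmin + πmax →
                     (1ℚ - fromℕ L * ε) * Z ≤ πmax
  forcedStep-bound {L} {Z} L≤n 0≤Z Z≤ = begin
    (1ℚ - Lε) * Z                   ≤⟨ *-monoˡ-≤ (1ℚ - Lε) (0≤1-p (fromℕ*ε≤1 L≤n)) Z≤ ⟩
    (1ℚ - Lε) * (fromℕ L * πmin + πmax)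
                                    ≡⟨ cong (λ p → (1ℚ - Lε) * (fromℕ L * p + πmax)) πmin≡ε*πmax ⟩
    (1ℚ - Lε) * (fromℕ L * (ε * πmax) + πmax)
                                    ≡⟨ solve 3 (λ l e p → (con 1ℚ :- l :* e) :* (l :* (e :* p) :+ p)
                                                       := p :- l :* e :* (l :* e) :* p) refl (fromℕ L) ε πmax ⟩
    πmax - Lε * Lε * πmax           ≤⟨ p-q≤p πmax (*-nonNeg (*-nonNeg Lε-nonNeg Lε-nonNeg) πmax-nonNeg) ⟩
    πmax                            ∎
    where
    open ℚ.≤-Reasoning
    Lε : ℚ
    Lε = fromℕ L * ε
    Lε-nonNeg : 0ℚ ≤ Lε
    Lε-nonNeg = *-nonNeg (frac-nonNeg L 1) ε-nonNeg

  third*3≡1 : third * fromℕ 3 ≡ 1ℚ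
  third*3≡1 = trans (frac-* 1 3 3 1) (frac-≡ 3 3 1 1 refl)

  tourStep-bound : ∀ {L Z} → L ℕ.≤ n → Z ≤ fromℕ L * πmin + fromℕ 2 * πmax → third * Z ≤ πmax
  tourStep-bound {L} {Z} L≤n Z≤ = begin
    third * Z                             ≤⟨ *-monoˡ-≤ third third-nonNeg Z≤ ⟩
    third * (fromℕ L * πmin + fromℕ 2 * πmax)
                                          ≤⟨ *-monoˡ-≤ third third-nonNeg
                                               (ℚ.+-monoˡ-≤ (fromℕ 2 * πmax) (fromℕ*πmin≤πmax L≤n)) ⟩
    third * (πmax + fromℕ 2 * πmax)       ≡⟨ solve 3 (λ t a p → t :* (p :+ a :* p) := t :* (con 1ℚ :+ a) :* p)
                                                   refl third (fromℕ 2) πmax ⟩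
    third * (1ℚ + fromℕ 2) * πmax         ≡⟨ cong (λ c → third * c * πmax) (fromℕ-+ 1 2) ⟨
    third * fromℕ 3 * πmax                ≡⟨ cong (_* πmax) third*3≡1 ⟩
    1ℚ * πmax                             ≡⟨ ℚ.*-identityˡ πmax ⟩
    πmax                                  ∎
    where open ℚ.≤-Reasoning

  offTourStep-bound : ∀ {L Z} → L ℕ.≤ n → Z ≤ fromℕ L * πmin + fromℕ 2 * πmax → (πmin * third) * Z ≤ πmin
  offTourStep-bound {L} {Z} L≤n Z≤ = begin
    πmin * third * Z                      ≤⟨ *-monoˡ-≤ (πmin * third) (*-nonNeg πmin-nonNeg third-nonNeg) Z≤ ⟩
    πmin * third * (fromℕ L * πmin + fromℕ 2 * πmax)
                                          ≤⟨ *-monoˡ-≤ (πmin * third) (*-nonNeg πmin-nonNeg third-nonNeg)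
                                               (ℚ.+-mono-≤ Lπmin≤1 (*-monoˡ-≤ (fromℕ 2) (frac-nonNeg 2 1) πmax≤1)) ⟩
    πmin * third * (1ℚ + fromℕ 2 * 1ℚ)    ≡⟨ solve 3 (λ p t a → p :* t :* (con 1ℚ :+ a :* con 1ℚ)
                                                          := p :* (t :* (con 1ℚ :+ a)))
                                                   refl πmin third (fromℕ 2) ⟩
    πmin * (third * (1ℚ + fromℕ 2))       ≡⟨ cong (λ c → πmin * (third * c)) (fromℕ-+ 1 2) ⟨
    πmin * (third * fromℕ 3)              ≡⟨ cong (πmin *_) third*3≡1 ⟩
    πmin * 1ℚ                             ≡⟨ ℚ.*-identityʳ πmin ⟩
    πmin                                  ∎
    where
    open ℚ.≤-Reasoning
    Lπmin≤1 : fromℕ L * πmin ≤ 1ℚ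
    Lπmin≤1 = ℚ.≤-trans (fromℕ*πmin≤πmax L≤n) πmax≤1

  β : ℚ
  β = πmin * third * third

  β-nonNeg : 0ℚ ≤ β
  β-nonNeg = *-nonNeg (*-nonNeg πmin-nonNeg third-nonNeg) third-nonNeg

  weight : Bool → ℚ
  weight true  = 1ℚ
  weight false = third

  weight-nonNeg : ∀ b → 0ℚ ≤ weight b
  weight-nonNeg true  = frac-nonNeg 1 1
  weight-nonNeg false = third-nonNeg

  weight≤1 : ∀ b → weight b ≤ 1ℚ
  weight≤1 true  = ℚ.≤-refl
  weight≤1 false = third≤1

  weight-*-≤ : ∀ b {p} → 0ℚ ≤ p → weight b * p ≤ p
  weight-*-≤ b {p} 0≤p = subst (weight b * p ≤_) (ℚ.*-identityˡ p)
    (ℚ.*-monoʳ-≤-nonNeg p {{ℚ.nonNegative 0≤p}} (weight≤1 b))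

  β≥1/9n² : frac 1 9 * frac 1 (n ℕ.* n) ≤ β
  β≥1/9n² = begin
    frac 1 9 * frac 1 (n ℕ.* n)  ≤⟨ *-monoˡ-≤ (frac 1 9) (frac-nonNeg 1 9)
                                      (frac-≤ 1 (n ℕ.* n) 1 (n ℕ.* (8 ℕ.+ m))
                                        (ℕ.*-monoʳ-≤ 1 (ℕ.*-monoʳ-≤ n (ℕ.m≤n+m (8 ℕ.+ m) 2)))) ⟩
    frac 1 9 * πmin              ≡⟨ cong (_* πmin) (frac-* 1 3 1 3) ⟨
    third * third * πmin         ≡⟨ solve 2 (λ t p → t :* t :* p := p :* t :* t) refl third πmin ⟩
    β                            ∎
    where open ℚ.≤-Reasoning

  β≤1 : β ≤ 1ℚ
  β≤1 = *-mono-≤-nonNeg (frac-nonNeg 1 1) third-nonNeg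
          (*-mono-≤-nonNeg (frac-nonNeg 1 1) third-nonNeg (frac≤1 1 (n ℕ.* (8 ℕ.+ m)) (s≤s z≤n)) third≤1)
          third≤1

  3/8≤1-loss : frac 3 8 ≤ 1ℚ - loss (9 ℕ.+ m)
  3/8≤1-loss = 1-q≤1-p (loss≤5/8 ℕ.≤-refl)

  frac1n*frac1n²^K : ∀ K → frac 1 n * frac 1 (n ℕ.* n) ^ℚ K ≡ frac 1 (n ℕ.^ (2 ℕ.* suc K ℕ.∸ 1))
  frac1n*frac1n²^K K = begin
    frac 1 n * frac 1 (n ℕ.* n) ^ℚ K      ≡⟨ cong (frac 1 n *_) (frac-^ℚ (n ℕ.* n) K) ⟩
    frac 1 n * frac 1 ((n ℕ.* n) ℕ.^ K)   ≡⟨ frac-* 1 n 1 ((n ℕ.* n) ℕ.^ K) ⟩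
    frac 1 (n ℕ.* (n ℕ.* n) ℕ.^ K)        ≡⟨ cong (frac 1) exponent ⟨
    frac 1 (n ℕ.^ (2 ℕ.* suc K ℕ.∸ 1))    ∎
    where
    open ≡-Reasoning
    instance
      n²^K≢0 : NonZero ((n ℕ.* n) ℕ.^ K)
      n²^K≢0 = ℕ.m^n≢0 (n ℕ.* n) K
    exponent : n ℕ.^ (2 ℕ.* suc K ℕ.∸ 1) ≡ n ℕ.* (n ℕ.* n) ℕ.^ K
    exponent = begin
      n ℕ.^ (2 ℕ.* suc K ℕ.∸ 1)      ≡⟨ cong (n ℕ.^_) (ℕ.+-suc K (K ℕ.+ 0)) ⟩
      n ℕ.* n ℕ.^ (2 ℕ.* K)          ≡⟨ cong (n ℕ.*_) (ℕ.^-*-assoc n 2 K) ⟨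
      n ℕ.* (n ℕ.^ 2) ℕ.^ K          ≡⟨ cong (λ c → n ℕ.* (n ℕ.* c) ℕ.^ K) (ℕ.*-identityʳ n) ⟩
      n ℕ.* (n ℕ.* n) ℕ.^ K          ∎

  -- Lower bound for completing a route with L steps left, j of them along added edges; b = true
  -- records that the current vertex has an x-neighbour already visited.
  potential : Bool → ℕ → ℕ → ℚ
  potential b j L = weight b * β ^ℚ j * (1ℚ - loss L)

  potential-nonNeg : ∀ b j {L} → L ℕ.≤ 9 ℕ.+ m → 0ℚ ≤ potential b j L
  potential-nonNeg b j L≤ = *-nonNeg (*-nonNeg (weight-nonNeg b) (^ℚ-nonNeg j β-nonNeg)) (0≤1-p (loss≤1 L≤))

  potential-done : ∀ b → potential b 0 0 ≤ 1ℚ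
  potential-done b = *-mono-≤-nonNeg (frac-nonNeg 1 1) (0≤1-p (loss≤1 z≤n))
    (weight-*-≤ b (frac-nonNeg 1 1)) (p-q≤p 1ℚ (loss-nonNeg 0))

  potential-forcedStep : ∀ j L → potential true j (suc L) ≤ (1ℚ - fromℕ (suc L) * ε) * potential true j L
  potential-forcedStep j L = subst (potential true j (suc L) ≤_) (sym split)
    (p≤p+q _ (*-nonNeg (*-nonNeg (^ℚ-nonNeg j β-nonNeg) (*-nonNeg (frac-nonNeg (suc L) 1) ε-nonNeg)) (loss-nonNeg L)))
    where
    split : (1ℚ - fromℕ (suc L) * ε) * potential true j L
          ≡ potential true j (suc L) + β ^ℚ j * (fromℕ (suc L) * ε) * loss L
    split = trans (solve 3 (λ B l s → (con 1ℚ :- l) :* (con 1ℚ :* B :* (con 1ℚ :- s))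
                                  := con 1ℚ :* B :* (con 1ℚ :- (s :+ l)) :+ B :* l :* s)
                    refl (β ^ℚ j) (fromℕ (suc L) * ε) (loss L))
                  (cong (λ s → 1ℚ * β ^ℚ j * (1ℚ - s) + β ^ℚ j * (fromℕ (suc L) * ε) * loss L) (sym (loss-suc L)))

  potential-tourStep : ∀ j L → potential false j (suc L) ≤ third * potential true j L
  potential-tourStep j L = subst (potential false j (suc L) ≤_) (sym split)
    (p≤p+q _ (*-nonNeg (*-nonNeg third-nonNeg (^ℚ-nonNeg j β-nonNeg)) (*-nonNeg (frac-nonNeg (suc L) 1) ε-nonNeg)))
    where
    split : third * potential true j L ≡ potential false j (suc L) + third * β ^ℚ j * (fromℕ (suc L) * ε)
    split = trans (solve 4 (λ t B l s → t :* (con 1ℚ :* B :* (con 1ℚ :- s))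
                                    := t :* B :* (con 1ℚ :- (s :+ l)) :+ t :* B :* l)
                    refl third (β ^ℚ j) (fromℕ (suc L) * ε) (loss L))
                  (cong (λ s → third * β ^ℚ j * (1ℚ - s) + third * β ^ℚ j * (fromℕ (suc L) * ε)) (sym (loss-suc L)))

  potential-offTourStep : ∀ b j {L} → suc L ℕ.≤ 9 ℕ.+ m →
                          potential b (suc j) (suc L) ≤ (πmin * third) * potential false j L
  potential-offTourStep b j {L} L<9+m = begin
    weight b * B * (1ℚ - loss (suc L)) ≤⟨ *-mono-≤-nonNeg (^ℚ-nonNeg (suc j) β-nonNeg) (0≤1-p (loss≤1 L<9+m))
                                            (weight-*-≤ b (^ℚ-nonNeg (suc j) β-nonNeg)) (1-q≤1-p loss-grows) ⟩
    B * (1ℚ - loss L)                   ≡⟨ solve 4 (λ p t P s → p :* t :* t :* P :* (con 1ℚ :- s)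
                                                         := p :* t :* (t :* P :* (con 1ℚ :- s)))
                                                refl πmin third (β ^ℚ j) (loss L) ⟩
    πmin * third * potential false j L  ∎
    where
    open ℚ.≤-Reasoning
    B : ℚ
    B = β ^ℚ suc j
    loss-grows : loss L ≤ loss (suc L)
    loss-grows = subst (loss L ≤_) (sym (loss-suc L)) (p≤p+q (loss L) (*-nonNeg (frac-nonNeg (suc L) 1) ε-nonNeg))

  potential-lowerBound : ∀ {J K} → J ℕ.≤ K →
    frac 1 9 ^ℚ K * frac 1 8 * frac 1 (n ℕ.^ (2 ℕ.* suc K ℕ.∸ 1)) ≤ frac 1 n * potential false J (9 ℕ.+ m)
  potential-lowerBound {J} {K} J≤K = begin
    N^K * frac 1 8 * frac 1 (n ℕ.^ (2 ℕ.* suc K ℕ.∸ 1))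
      ≡⟨ cong₂ (λ a b → N^K * a * b) (sym third*3/8) (sym (frac1n*frac1n²^K K)) ⟩
    N^K * (third * frac 3 8) * (frac 1 n * M^K)
      ≡⟨ solve 5 (λ P t a n Q → P :* (t :* a) :* (n :* Q) := n :* (t :* (P :* Q) :* a))
               refl N^K third (frac 3 8) (frac 1 n) M^K ⟩
    frac 1 n * (third * (N^K * M^K) * frac 3 8)
      ≤⟨ *-monoˡ-≤ (frac 1 n) (frac-nonNeg 1 n)
           (*-mono-≤-nonNeg (*-nonNeg third-nonNeg (^ℚ-nonNeg J β-nonNeg)) (frac-nonNeg 3 8)
             (*-monoˡ-≤ third third-nonNeg β^J-bound) 3/8≤1-loss) ⟩
    frac 1 n * potential false J (9 ℕ.+ m) ∎
    where
    open ℚ.≤-Reasoning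
    N^K M^K : ℚ
    N^K = frac 1 9 ^ℚ K
    M^K = frac 1 (n ℕ.* n) ^ℚ K
    third*3/8 : third * frac 3 8 ≡ frac 1 8
    third*3/8 = trans (frac-* 1 3 3 8) (frac-≡ 3 24 1 8 refl)
    β^J-bound : N^K * M^K ≤ β ^ℚ J
    β^J-bound = begin
      N^K * M^K                          ≡⟨ ^ℚ-distribʳ-* (frac 1 9) (frac 1 (n ℕ.* n)) K ⟨
      (frac 1 9 * frac 1 (n ℕ.* n)) ^ℚ K ≤⟨ ^ℚ-monoˡ-≤ K (*-nonNeg (frac-nonNeg 1 9) (frac-nonNeg 1 (n ℕ.* n)))
                                                β≥1/9n² ⟩
      β ^ℚ K                             ≤⟨ ^ℚ-antitoneʳ β-nonNeg β≤1 J≤K ⟩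
      β ^ℚ J                             ∎

module Walk (m : ℕ) (x y : Tour (10 ℕ.+ m)) where

  open import Data.Rational as ℚ using (ℚ; 0ℚ; 1ℚ; _≤_; _<_; _+_; _*_; _-_)
  import Data.Rational.Properties as ℚ
  open import Data.Rational.Solver using (module +-*-Solver)
  open +-*-Solver
  open RationalFacts
  open Cycles
  open Constants m

  π : Fin n → Fin n → ℚ
  π = piMat x

  π-diag : ∀ v → π v v ≡ 0ℚ
  π-diag v with v ≟ v
  ... | yes _   = refl
  ... | no v≢v = ⊥-elim (v≢v refl)

  π-offDiag : ∀ {v w} → v ≢ w → π v w ≡ (if adj x v w then πmax else πmin)
  π-offDiag {v} {w} v≢w with v ≟ w
  ... | yes v≡w = ⊥-elim (v≢w v≡w)
  ... | no _    = refl

  π-pos : ∀ {v w} → v ≢ w → 0ℚ < π v w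
  π-pos {v} {w} v≢w = subst (0ℚ <_) (sym (π-offDiag v≢w)) (offDiag (adj x v w))
    where
    offDiag : ∀ b → 0ℚ < (if b then πmax else πmin)
    offDiag true  = πmax-pos
    offDiag false = πmin-pos

  π-nonNeg : ∀ v w → 0ℚ ≤ π v w
  π-nonNeg v w = byCases (v ≟ w)
    where
    byCases : Dec (v ≡ w) → 0ℚ ≤ π v w
    byCases (yes refl) = ℚ.≤-reflexive (sym (π-diag v))
    byCases (no v≢w)   = ℚ.<⇒≤ (π-pos v≢w)

  π-≤ : ∀ v w → π v w ≤ πmin + fromℕ (indicator (adj x v w)) * πmax
  π-≤ v w = byCases (v ≟ w)
    where
    bound : ℚ
    bound = πmin + fromℕ (indicator (adj x v w)) * πmax
    byCases : Dec (v ≡ w) → π v w ≤ bound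
    byCases (yes refl) = subst (_≤ bound) (sym (π-diag v))
                           (ℚ.+-mono-≤ πmin-nonNeg (*-nonNeg (frac-nonNeg (indicator (adj x v v)) 1) πmax-nonNeg))
    byCases (no v≢w)   = subst (_≤ bound) (sym (π-offDiag v≢w)) (offDiag (adj x v w))
      where
      offDiag : ∀ b → (if b then πmax else πmin) ≤ πmin + fromℕ (indicator b) * πmax
      offDiag true  = subst (_≤ πmin + 1ℚ * πmax) (ℚ.+-identityˡ πmax)
                        (ℚ.+-mono-≤ πmin-nonNeg (ℚ.≤-reflexive (sym (ℚ.*-identityˡ πmax))))
      offDiag false = ℚ.≤-reflexive (sym (trans (cong (πmin +_) (ℚ.*-zeroˡ πmax)) (ℚ.+-identityʳ πmin)))

  Z : Fin n → List (Fin n) → ℚ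
  Z v U = sumQ (map (π v) U)

  Z-nonNeg : ∀ v U → 0ℚ ≤ Z v U
  Z-nonNeg v U = sumQ-nonNeg (π v) U (π-nonNeg v)

  Z-≤ : ∀ v U → Z v U ≤ fromℕ (length U) * πmin + fromℕ (countTrue (adj x v) U) * πmax
  Z-≤ v []      = ℚ.≤-reflexive (solve 2 (λ p q → con 0ℚ := con 0ℚ :* p :+ con 0ℚ :* q) refl πmin πmax)
  Z-≤ v (u ∷ U) = begin
    π v u + Z v U                             ≤⟨ ℚ.+-mono-≤ (π-≤ v u) (Z-≤ v U) ⟩
    πmin + a * πmax + (l * πmin + c * πmax)   ≡⟨ solve 5 (λ p P a l c → p :+ a :* P :+ (l :* p :+ c :* P)
                                                              := (con 1ℚ :+ l) :* p :+ (a :+ c) :* P)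
                                                   refl πmin πmax a l c ⟩
    (1ℚ + l) * πmin + (a + c) * πmax          ≡⟨ cong₂ (λ s t → s * πmin + t * πmax)
                                                   (fromℕ-+ 1 (length U)) (fromℕ-+ (indicator (adj x v u)) _) ⟨
    fromℕ (suc (length U)) * πmin + fromℕ (countTrue (adj x v) (u ∷ U)) * πmax ∎
    where
    open ℚ.≤-Reasoning
    a l c : ℚ
    a = fromℕ (indicator (adj x v u))
    l = fromℕ (length U)
    c = fromℕ (countTrue (adj x v) U)

  Z-≤-two : ∀ v {U} → Unique U → Z v U ≤ fromℕ (length U) * πmin + fromℕ 2 * πmax
  Z-≤-two v {U} uU = ℚ.≤-trans (Z-≤ v U)
    (ℚ.+-monoʳ-≤ (fromℕ (length U) * πmin) (ℚ.*-monoʳ-≤-nonNeg πmax {{ℚ.nonNegative πmax-nonNeg}}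
                      (fromℕ-mono-≤ (countTrue-≤2 (adj-atMostTwo x v) U uU))))

  Z-≤-one : ∀ v {U u₀} → Unique U → adj x v u₀ ≡ true → u₀ ∉ U →
            Z v U ≤ fromℕ (length U) * πmin + πmax
  Z-≤-one v {U} uU vu₀ u₀∉U = ℚ.≤-trans (Z-≤ v U)
    (ℚ.+-monoʳ-≤ (fromℕ (length U) * πmin) (subst (fromℕ (countTrue (adj x v) U) * πmax ≤_) (ℚ.*-identityˡ πmax)
      (ℚ.*-monoʳ-≤-nonNeg πmax {{ℚ.nonNegative πmax-nonNeg}}
        (fromℕ-mono-≤ (countTrue-≤1 (adj-atMostTwo x v) U uU vu₀ u₀∉U)))))

  stepProb : Fin n → List (Fin n) → Fin n → ℚ
  stepProb v U w = divQ (π v w) (Z v U)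

  stepProb-nonNeg : ∀ v U w → 0ℚ ≤ stepProb v U w
  stepProb-nonNeg v U w = divQ-nonNeg (π v w) (Z v U) (π-nonNeg v w) (Z-nonNeg v U)

  go-nonNeg : ∀ f path v U → 0ℚ ≤ go x y f path v U
  go-nonNeg f       path v [] with sameCycleB (path ʳ++ []) (proj₁ y)
  ... | true  = frac-nonNeg 1 1
  ... | false = ℚ.≤-refl
  go-nonNeg zero    path v (_ ∷ _) = ℚ.≤-refl
  go-nonNeg (suc f) path v U@(_ ∷ _) =
    sumQ-nonNeg _ U (λ w → *-nonNeg (stepProb-nonNeg v U w) (go-nonNeg f (w ∷ path) w (remove w U)))

  walk-step : ∀ {f path v U w} c {Φ} → w ∈ U → v ≢ w → c * Z v U ≤ π v w →
              0ℚ ≤ Φ → Φ ≤ go x y f (w ∷ path) w (remove w U) → c * Φ ≤ go x y (suc f) path v U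
  walk-step {f} {path} {v} {U@(_ ∷ _)} {w} c {Φ} w∈U v≢w cZ≤π 0≤Φ Φ≤go = begin
    c * Φ                                             ≤⟨ *-mono-≤-nonNeg (stepProb-nonNeg v U w) 0≤Φ c≤p Φ≤go ⟩
    stepProb v U w * go x y f (w ∷ path) w (remove w U) ≤⟨ ∈⇒≤sumQ term term-nonNeg w∈U ⟩
    go x y (suc f) path v U                           ∎
    where
    open ℚ.≤-Reasoning
    term : Fin n → ℚ
    term w′ = stepProb v U w′ * go x y f (w′ ∷ path) w′ (remove w′ U)
    term-nonNeg : ∀ w′ → 0ℚ ≤ term w′
    term-nonNeg w′ = *-nonNeg (stepProb-nonNeg v U w′) (go-nonNeg f (w′ ∷ path) w′ (remove w′ U))
    c≤p : c ≤ stepProb v U w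
    c≤p = divQ-≥ (π v w) (Z v U) (ℚ.<-≤-trans (π-pos v≢w) (∈⇒≤sumQ (π v) (π-nonNeg v) w∈U)) cZ≤π

  π-tour : ∀ {v w} → v ≢ w → adj x v w ≡ true → π v w ≡ πmax
  π-tour v≢w vw = trans (π-offDiag v≢w) (cong (if_then πmax else πmin) vw)

  π-offTour : ∀ {v w} → v ≢ w → adj x v w ≡ false → π v w ≡ πmin
  π-offTour v≢w vw = trans (π-offDiag v≢w) (cong (if_then πmax else πmin) vw)

  forcedStep-factor : ∀ {v w U u₀ L} → v ≢ w → adj x v w ≡ true → Unique U → adj x v u₀ ≡ true → u₀ ∉ U →
                      length U ≡ L → L ℕ.≤ n → (1ℚ - fromℕ L * ε) * Z v U ≤ π v w
  forcedStep-factor {v} {U = U} v≢w vw uU vu₀ u₀∉U refl L≤n = subst (_ ≤_) (sym (π-tour v≢w vw))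
    (forcedStep-bound L≤n (Z-nonNeg v U) (Z-≤-one v uU vu₀ u₀∉U))

  tourStep-factor : ∀ {v w U L} → v ≢ w → adj x v w ≡ true → Unique U →
                    length U ≡ L → L ℕ.≤ n → third * Z v U ≤ π v w
  tourStep-factor {v} v≢w vw uU refl L≤n = subst (_ ≤_) (sym (π-tour v≢w vw))
    (tourStep-bound L≤n (Z-≤-two v uU))

  offTourStep-factor : ∀ {v w U L} → v ≢ w → adj x v w ≡ false → Unique U →
                       length U ≡ L → L ℕ.≤ n → (πmin * third) * Z v U ≤ π v w
  offTourStep-factor {v} v≢w vw uU refl L≤n = subst (_ ≤_) (sym (π-offTour v≢w vw))
    (offTourStep-bound L≤n (Z-≤-two v uU))

  VisitedNeighbour : Bool → Fin n → List (Fin n) → Set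
  VisitedNeighbour b v rs = b ≡ true → ∃ λ u₀ → u₀ ∉ rs × adj x v u₀ ≡ true

  module Step {f : ℕ} {path U rest : List (Fin n)} {v w : Fin n} (uvwrest : Unique (v ∷ w ∷ rest)) (U↭ : U ↭ w ∷ rest)
              (L<9+m : suc (length rest) ℕ.≤ 9 ℕ.+ m) where

    J L : ℕ
    J = length (offTourSteps x (w ∷ rest))
    L = length rest

    TailBound : Bool → Set
    TailBound b = potential b J L ≤ go x y f (w ∷ path) w (remove w U)

    private
      v∉wrest : v ∉ w ∷ rest
      v∉wrest = Unique[x∷xs]⇒x∉xs uvwrest

      v≢w : v ≢ w
      v≢w v≡w = v∉wrest (here v≡w)

      uU : Unique U
      uU = unique-resp-↭ (AllPairs.tail uvwrest) (↭-sym U↭)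

      |U| : length U ≡ suc L
      |U| = ↭.↭-length U↭

      L<n : suc L ℕ.≤ n
      L<n = ℕ.≤-trans L<9+m (ℕ.n≤1+n _)

      L≤9+m : L ℕ.≤ 9 ℕ.+ m
      L≤9+m = ℕ.<⇒≤ L<9+m

      transition : ∀ c {Φ} → c * Z v U ≤ π v w → 0ℚ ≤ Φ → Φ ≤ go x y f (w ∷ path) w (remove w U) →
                   c * Φ ≤ go x y (suc f) path v U
      transition c = walk-step c (↭.∈-resp-↭ (↭-sym U↭) (here refl)) v≢w

      backToV : adj x v w ≡ true → VisitedNeighbour true w rest
      backToV vw _ = v , (λ v∈rest → v∉wrest (there v∈rest)) , trans (adj-sym x w v) vw

    -- The case split goes through an argument instead of with: with-abstraction would normalise
    -- the rational arithmetic in the goal.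
    bound : ∀ b → VisitedNeighbour b v (w ∷ rest) → (∀ b′ → VisitedNeighbour b′ w rest → TailBound b′) →
            potential b (length (offTourSteps x (v ∷ w ∷ rest))) (suc L) ≤ go x y (suc f) path v U
    bound b visited ih = byAdj b (adj x v w) refl visited
      where
      byAdj : ∀ b a → adj x v w ≡ a → VisitedNeighbour b v (w ∷ rest) →
              potential b (length (if a then offTourSteps x (w ∷ rest) else (v , w) ∷ offTourSteps x (w ∷ rest))) (suc L)
                ≤ go x y (suc f) path v U
      byAdj true  true  vw visited = let (u₀ , u₀∉ , vu₀) = visited refl in
        ℚ.≤-trans (potential-forcedStep J L)
          (transition (1ℚ - fromℕ (suc L) * ε)
            (forcedStep-factor v≢w vw uU vu₀ (λ u₀∈U → u₀∉ (↭.∈-resp-↭ U↭ u₀∈U)) |U| L<n)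
            (potential-nonNeg true J L≤9+m) (ih true (backToV vw)))
      byAdj false true  vw _ =
        ℚ.≤-trans (potential-tourStep J L)
          (transition third (tourStep-factor v≢w vw uU |U| L<n)
            (potential-nonNeg true J L≤9+m) (ih true (backToV vw)))
      byAdj b     false vw _ =
        ℚ.≤-trans (potential-offTourStep b J L<9+m)
          (transition (πmin * third) (offTourStep-factor v≢w vw uU |U| L<n)
            (potential-nonNeg false J L≤9+m) (ih false λ ()))

  -- path is the visited prefix in reverse, so path ʳ++ rs is the whole route.
  walk-bound : ∀ rs f path v U b → sameCycleB (path ʳ++ rs) (proj₁ y) ≡ true →
               length rs ℕ.≤ f → length rs ℕ.≤ 9 ℕ.+ m → Unique (v ∷ rs) → U ↭ rs →
               VisitedNeighbour b v rs →
               potential b (length (offTourSteps x (v ∷ rs))) (length rs) ≤ go x y f path v U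
  walk-bound [] f path v U b closes _ _ _ U↭[] _ =
    subst (λ U → potential b 0 0 ≤ go x y f path v U) (sym (↭.↭-empty-inv U↭[]))
      (subst (λ c → potential b 0 0 ≤ (if c then 1ℚ else 0ℚ)) (sym closes) (potential-done b))
  walk-bound (w ∷ rest) (suc f) path v U b closes (s≤s len≤f) len≤ uvwrest U↭ visited =
    Step.bound uvwrest U↭ len≤ b visited λ b′ visited′ →
      walk-bound rest f (w ∷ path) w (remove w U) b′ closes len≤f (ℕ.≤-trans (ℕ.n≤1+n _) len≤)
                 (AllPairs.tail uvwrest) (remove-↭ U↭ (Unique[x∷xs]⇒x∉xs (AllPairs.tail uvwrest))) visited′

  -- xs is explicit: inferring it would unfold outProb x y over all n vertices.
  outProb-≥ : ∀ w → frac 1 n * go x y n (w ∷ []) w (remove w (vertices n)) ≤ outProb x y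
  outProb-≥ w = ∈⇒≤sumQ (λ v → frac 1 n * go x y n (v ∷ []) v (remove v (vertices n))) {xs = vertices n}
    (λ v → *-nonNeg (frac-nonNeg 1 n) (go-nonNeg n (v ∷ []) v (remove v (vertices n)))) (∈.∈-allFin w)

  route-bound : ∀ {w rest} → sameCycleB (w ∷ rest) (proj₁ y) ≡ true → (w ∷ rest) ↭ vertices n →
                frac 1 n * potential false (length (offTourSteps x (w ∷ rest))) (9 ℕ.+ m) ≤ outProb x y
  route-bound {w} {rest} closes route↭V = ℚ.≤-trans
    (*-monoˡ-≤ (frac 1 n) (frac-nonNeg 1 n)
      (subst (λ L → potential false (length (offTourSteps x (w ∷ rest))) L ≤ fromW) |rest|
        (walk-bound rest n (w ∷ []) w (remove w (vertices n)) false closes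
          (ℕ.≤-trans (ℕ.≤-reflexive |rest|) (ℕ.n≤1+n _)) (ℕ.≤-reflexive |rest|) uroute
          (remove-↭ (↭-sym route↭V) (Unique[x∷xs]⇒x∉xs uroute)) λ ())))
    (outProb-≥ w)
    where
    fromW : ℚ
    fromW = go x y n (w ∷ []) w (remove w (vertices n))
    uroute : Unique (w ∷ rest)
    uroute = unique-resp-↭ (allFin⁺ n) (↭-sym route↭V)
    |rest| : length rest ≡ 9 ℕ.+ m
    |rest| = ℕ.suc-injective (trans (↭.↭-length route↭V) (List.length-tabulate (λ i → i)))

module Exchange (m : ℕ) (x y : Tour (10 ℕ.+ m)) {K} (exchange : KExchange (suc K) x y) where

  open import Data.Rational as ℚ using (ℚ; _≤_; _*_)
  import Data.Rational.Properties as ℚ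
  open RationalFacts
  open Cycles
  open Constants m
  open Walk m x y

  R A : List (Fin n × Fin n)
  R = proj₁ exchange
  A = proj₁ (proj₂ exchange)

  |A| : length A ≡ suc K
  |A| = proj₁ (proj₂ (proj₂ (proj₂ exchange)))

  A-offTour : All (λ e → (adj x (proj₁ e) (proj₂ e) ≡ false) × (proj₁ e ≢ proj₂ e)) A
  A-offTour = proj₁ (proj₂ (proj₂ (proj₂ (proj₂ (proj₂ exchange)))))

  y-edges : ∀ i j → adj y i j ≡ ((adj x i j ∧ not (inU R i j)) ∨ inU A i j)
  y-edges = proj₂ (proj₂ (proj₂ (proj₂ (proj₂ (proj₂ (proj₂ (proj₂ exchange)))))))

  y-offTour⇒added : ∀ {i j} → adj y i j ≡ true → adj x i j ≡ false → inU A i j ≡ true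
  y-offTour⇒added {i} {j} yij xij = trans (sym (cong (λ a → (a ∧ not (inU R i j)) ∨ inU A i j) xij))
                                          (trans (sym (y-edges i j)) yij)

  added⇒y : ∀ {i j} → adj x i j ≡ false → inU A i j ≡ true → adj y i j ≡ true
  added⇒y {i} {j} xij Aij = trans (y-edges i j) (cong₂ (λ a b → (a ∧ not (inU R i j)) ∨ b) xij Aij)

  AddedTourEdge : Set
  AddedTourEdge = ∃₂ λ u w → (u ≢ w) × (adj x u w ≡ false) × ((u , w) ∈ edgesL (proj₁ y))

  addedTourEdge : AddedTourEdge
  addedTourEdge = let (a , a∈A) = someElement A |A| in orient a∈A (All.lookup A-offTour a∈A)
    where
    someElement : ∀ (B : List (Fin n × Fin n)) → length B ≡ suc K → ∃ (_∈ B)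
    someElement (b ∷ _) _ = b , here refl
    orient : ∀ {a₁ a₂} → (a₁ , a₂) ∈ A → (adj x a₁ a₂ ≡ false) × (a₁ ≢ a₂) → AddedTourEdge
    orient {a₁} {a₂} a∈A (xa , a≢)
      with inU-sound (edgesL (proj₁ y)) a₁ a₂ (added⇒y xa (inU-complete a₁ a₂ a∈A (sameEdgeB-refl a₁ a₂)))
    ... | (u , w) , uw∈y , uw~a with sameEdgeB-sound u w a₁ a₂ uw~a
    ... | inj₁ (refl , refl) = u , w , a≢ , xa , uw∈y
    ... | inj₂ (refl , refl) = u , w , (λ u≡w → a≢ (sym u≡w)) , trans (adj-sym x u w) xa , uw∈y

  offTourSteps-≤ : ∀ {u w} b mid → adj x u w ≡ false → adj y u w ≡ true → Unique (w ∷ b ∷ mid ++ [ u ]) →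
                   (∀ i j → adjL (w ∷ b ∷ mid ++ [ u ]) i j ≡ adj y i j) →
                   length (offTourSteps x (w ∷ b ∷ mid ++ [ u ])) ℕ.≤ K
  offTourSteps-≤ {u} {w} b mid xuw yuw ur sameAdj = ℕ.≤-pred (subst (suc (length steps) ℕ.≤_) |A|
    (distinctEdges-length-≤ ((u , w) ∷ steps) A
      (closingEdge-fresh x ur (∈.∈-++⁺ʳ mid (here refl)) ∷ offTourSteps-distinct x route ur)
      (y-offTour⇒added yuw xuw ∷
        All.map added (All.zip (offTourSteps-offTour x route , offTourSteps-⊆-zip x w (b ∷ mid ++ [ u ]) w)))))
    where
    route : List (Fin n)
    route = w ∷ b ∷ mid ++ [ u ]
    steps : List (Fin n × Fin n)
    steps = offTourSteps x route
    added : ∀ {e} → (adj x (proj₁ e) (proj₂ e) ≡ false) × (e ∈ edgesL route) →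
            inU A (proj₁ e) (proj₂ e) ≡ true
    added {e₁ , e₂} (xe , e∈route) =
      y-offTour⇒added (trans (sym (sameAdj e₁ e₂)) (inU-complete e₁ e₂ e∈route (sameEdgeB-refl e₁ e₂))) xe

  targetBound : ℚ
  targetBound = frac 1 9 ^ℚ K * frac 1 8 * frac 1 (n ℕ.^ (2 ℕ.* suc K ℕ.∸ 1))

  exchange-bound : targetBound ≤ outProb x y
  exchange-bound = viaAddedEdge addedTourEdge
    where
    viaAddedEdge : AddedTourEdge → targetBound ≤ outProb x y
    viaAddedEdge (u , w , u≢w , xuw , uw∈y) = viaRoute mid perm sameAdj
      where
      open Rotation (rotate-to (proj₁ y) u≢w uw∈y)
      viaRoute : ∀ mid → (w ∷ mid ++ [ u ]) ↭ proj₁ y → (∀ i j → adjL (w ∷ mid ++ [ u ]) i j ≡ adj y i j) →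
                 targetBound ≤ outProb x y
      viaRoute []        route↭y _ = ⊥-elim (2≢n (trans (↭.↭-length (↭-trans route↭y (proj₂ y)))
                                                        (List.length-tabulate (λ i → i))))
        where
        2≢n : 2 ≢ n
        2≢n ()
      viaRoute (b ∷ mid) route↭y sameAdj = ℚ.≤-trans
        (potential-lowerBound (offTourSteps-≤ b mid xuw (inU-complete u w uw∈y (sameEdgeB-refl u w)) uroute sameAdj))
        (route-bound (sameCycleB-complete (w ∷ b ∷ mid ++ [ u ]) (proj₁ y) sameAdj) (↭-trans route↭y (proj₂ y)))
        where
        uroute : Unique (w ∷ b ∷ mid ++ [ u ])
        uroute = unique-resp-↭ (tour-unique y) (↭-sym route↭y)

open import Data.Nat using (ℕ; _≤_; _*_; _∸_; _^_)
open import Data.Rational using (ℚ; 0ℚ) renaming (_<_ to _<ℚ_; _≤_ to _≤ℚ_; _*_ to _*ℚ_)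
open import Data.Product using (Σ; _×_)

claim1 : (k : ℕ) → 2 ≤ k →
    Σ ℚ (λ c → (0ℚ <ℚ c) × Σ ℕ (λ N → (n : ℕ) → N ≤ n → k ≤ n →
    (x y : Tour n) → KExchange k x y →
    c *ℚ frac 1 (n ^ (2 * k ∸ 1)) ≤ℚ outProb x y))
claim1 (suc (suc K)) (s≤s (s≤s _)) =
  frac 1 9 ^ℚ suc K *ℚ frac 1 8 , c-pos , 10 , λ n 10≤n _ → byOffset (ℕ.m≤n⇒∃[o]m+o≡n 10≤n)
  where
  open RationalFacts
  c-pos : 0ℚ <ℚ frac 1 9 ^ℚ suc K *ℚ frac 1 8
  c-pos = *-pos (^ℚ-pos (suc K) (frac-< 0 1 1 9 (s≤s ℕ.z≤n))) (frac-< 0 1 1 8 (s≤s ℕ.z≤n))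
  byOffset : ∀ {n} → Σ ℕ (λ m → 10 ℕ.+ m ≡ n) → (x y : Tour n) → KExchange (suc (suc K)) x y →
             frac 1 9 ^ℚ suc K *ℚ frac 1 8 *ℚ frac 1 (n ^ (2 * suc (suc K) ∸ 1)) ≤ℚ outProb x y
  byOffset (m , refl) x y = Exchange.exchange-bound m x y
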